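{- Let $G$ be a group and $H\leq A \leq G$. If there exists an element $x\in G\setminus A$ such that $x^{2}\in A$, $xA$ contains no element whose square is contained in a conjugate of $H$ in $A$ (i.e. in some $b^{ -1}Hb$ with $b\in A$) and $|A:A\cap xAx^{ -1}|$ is an odd integer, then $A$ is not a perfect code of $(G,H)$.
   Context: All groups are finite. For a group $G$, a subgroup $H\leq G$ and a subset $U\subseteq G$ which is a union of double cosets of $H$ with $H\cap U=\emptyset$ and $U^{ -1}=U$, the coset graph $\mathrm{Cos}(G,H,U)$ has as vertex set the set of left cosets of $H$ in $G$, with $g_1H$ and $g_2H$ adjacent iff $g_1^{ -1}g_2\in U$. A perfect code in a graph is an independent set $C$ of vertices such that every vertex outside $C$ is adjacent to exactly one vertex of $C$. For $H\leq A\leq G$, $A$ is called a perfect code of the pair $(G,H)$ if there is a coset graph $\mathrm{Cos}(G,H,U)$ in which the set $\{aH: a\in A\}$ of left cosets of $H$ contained in $A$ is a perfect code. -}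

module Defs where

open import Data.Nat using (ℕ; _*_; _%_)
open import Data.Fin using (Fin)
open import Data.Fin.Subset using (Subset; _∈_; _∉_; ∣_∣)
open import Data.Bool using (_∧_)
open import Data.Vec using (lookup; tabulate)
open import Data.Product using (Σ; ∃; _×_; _,_)
open import Relation.Binary.PropositionalEquality using (_≡_)
open import Relation.Nullary using (¬_)
open import Algebra.Structures using (IsGroup)

-- A finite group: carrier Fin n (every finite group is isomorphic to one
-- of this form), with group laws w.r.t. propositional equality.
record FinGroup : Set where
  infixl 7 _∙_
  infix 8 _⁻¹
  field
    n       : ℕ
    _∙_     : Fin n → Fin n → Fin n
    e       : Fin n
    _⁻¹     : Fin n → Fin n
    isGroup : IsGroup _≡_ _∙_ e _⁻¹

module _ (G : FinGroup) where
  open FinGroup G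

  record IsSubgroup (S : Subset n) : Set where
    field
      e∈   : e ∈ S
      ∙∈   : ∀ {a b} → a ∈ S → b ∈ S → a ∙ b ∈ S
      ⁻¹∈  : ∀ {a} → a ∈ S → a ⁻¹ ∈ S

  _⊆ₛ_ : Subset n → Subset n → Set
  S ⊆ₛ T = ∀ {g} → g ∈ S → g ∈ T

  record IsConnectionSet (H U : Subset n) : Set where
    field
      doubleCosetUnion : ∀ {h u h'} → h ∈ H → u ∈ U → h' ∈ H → h ∙ u ∙ h' ∈ U
      disjoint         : ∀ {g} → g ∈ H → g ∉ U
      inverseClosed    : ∀ {u} → u ∈ U → u ⁻¹ ∈ U

  -- Vertices of Cos(G,H,U) are left cosets gH, represented by g;
  -- g₁H = g₂H iff g₁⁻¹g₂ ∈ H, and g₁H ~ g₂H iff g₁⁻¹g₂ ∈ U.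
  SameCoset : Subset n → Fin n → Fin n → Set
  SameCoset H g₁ g₂ = g₁ ⁻¹ ∙ g₂ ∈ H

  Adjacent : Subset n → Fin n → Fin n → Set
  Adjacent U g₁ g₂ = g₁ ⁻¹ ∙ g₂ ∈ U

  -- The set C = {aH : a ∈ A} is a perfect code in Cos(G,H,U):
  -- independent, and every vertex gH ∉ C (i.e. g ∉ A, as A is a union of
  -- left H-cosets) is adjacent to exactly one vertex of C.
  record IsPerfectCodeIn (H U A : Subset n) : Set where
    field
      independent : ∀ {a₁ a₂} → a₁ ∈ A → a₂ ∈ A → ¬ Adjacent U a₁ a₂
      covers      : ∀ {g} → g ∉ A → Σ (Fin n) λ a → a ∈ A × Adjacent U a g
      unique      : ∀ {g a₁ a₂} → g ∉ A → a₁ ∈ A → a₂ ∈ A →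
                    Adjacent U a₁ g → Adjacent U a₂ g → SameCoset H a₁ a₂

  -- A is a perfect code of the pair (G,H) (assumes H ≤ A ≤ G).
  IsPerfectCodeOfPair : Subset n → Subset n → Set
  IsPerfectCodeOfPair H A =
    Σ (Subset n) λ U → IsConnectionSet H U × IsPerfectCodeIn H U A

  -- A ∩ xAx⁻¹, where g ∈ xAx⁻¹ iff x⁻¹gx ∈ A.
  conjInter : Subset n → Fin n → Subset n
  conjInter A x = tabulate λ g → lookup A g ∧ lookup A (x ⁻¹ ∙ g ∙ x)

  OddIndex : Subset n → Subset n → Set
  OddIndex A B = Σ ℕ λ k → ∣ A ∣ ≡ k * ∣ B ∣ × k % 2 ≡ 1

-- Suppose U makes C = {aH : a ∈ A} a perfect code of Cos(G,H,U), and count the pairs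
-- (c , u) with c ∈ A, u ∈ U and xcu⁻¹ ∈ A: these are the edges between C and the vertices
-- xcH.  Every such vertex lies outside C, so it has exactly one neighbouring coset a₀H in C,
-- which gives |H| pairs for each c.  For fixed u the admissible c form a right coset of
-- x⁻¹Bx, where B = A ∩ xAx⁻¹.  Hence |A| |H| = |U ∩ AxA| |B|.  On the other hand U ∩ AxA
-- is a union of (H,H)-double cosets, closed under inversion because x² ∈ A, and none of its
-- double cosets HsH contains s⁻¹, as otherwise some element of xA would square into a
-- conjugate of H by an element of A.  So its double cosets pair off as HsH ≠ Hs⁻¹H, 2|H|
-- divides |U ∩ AxA|, and |A : B| = |A| / |B| is even.
module Submission where

open import Defs
open import Data.Fin using (Fin)
open import Data.Fin.Subset using (Subset; _∈_; _∉_)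
open import Data.Product using (Σ; _×_)
open import Relation.Nullary using (¬_)

open import Algebra.Bundles using (Group)
open import Algebra.Structures using (IsGroup)
open import Data.Bool using (Bool; true; false; not; _∧_; if_then_else_)
import Data.Bool.Properties as Bool
open import Data.Fin.Permutation as Perm using (Permutation′; permutation; _⟨$⟩ʳ_)
import Data.Fin.Properties as Fin
open import Data.Fin.Subset using (inside; outside; ∣_∣)
open import Data.Fin.Subset.Properties using (_∈?_; x∈p⇒∣p-x∣<∣p∣)
open import Data.List using (List; []; _∷_)
open import Data.Nat using (ℕ; zero; suc; _+_; _*_; _≤_; _<_; s≤s; s≤s⁻¹; z≤n; NonZero; >-nonZero)
open import Data.Nat.Divisibility using (_∣_; divides; _∣0; ∣-refl; ∣m∣n⇒∣m+n; *-monoʳ-∣; n∣m⇒m%n≡0)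
open import Data.Nat.Properties
  using ( ≤-refl; <⇒≱; m<n⇒0<n; +-identityʳ; +-comm; +-monoʳ-≤; m≤m+n; *-assoc; *-comm; *-cancelʳ-≡
        ; module ≤-Reasoning; +-0-commutativeMonoid; +-*-semiring)
open import Data.Product using (_,_; proj₁; proj₂)
open import Data.Product.Properties using (≡-dec)
open import Data.Sum using (_⊎_; inj₁; inj₂)
open import Data.Vec using (Vec; []; _∷_; lookup)
open import Data.Vec.Functional using (removeAt)
open import Data.Vec.Properties using (lookup∘tabulate; []=⇒lookup; lookup⇒[]=)
open import Function using (id; _∘_)
open import Level using (Level; 0ℓ)
open import Relation.Binary.Core using (Rel)
open import Relation.Binary.PropositionalEquality using (_≡_; refl; sym; trans; cong; cong₂; subst; module ≡-Reasoning)
open import Relation.Binary.Structures using (IsDecEquivalence)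
import Relation.Binary.Reflection as Reflection
open import Relation.Nullary using (Dec; yes; no; does; contradiction; _×-dec_; _⊎-dec_; ¬?)
open import Relation.Unary using (Pred; Decidable)
open import Algebra.Properties.CommutativeMonoid.Sum +-0-commutativeMonoid
  using (sum; sum-cong-≗; sum-remove; sum-replicate-zero; ∑-comm; ∑-permute; ∑-distrib-+)
open import Algebra.Properties.Semiring.Sum +-*-semiring using (*-distribʳ-sum)

private
  variable
    p q r : Level
    m : ℕ
    P : Pred (Fin m) p
    Q : Pred (Fin m) q

-- Reduced words in a group

module GroupWords {c ℓ} (G : Group c ℓ) where

  open Group G renaming (refl to ≈-refl; sym to ≈-sym; trans to ≈-trans)
  open import Algebra.Properties.Group G using (⁻¹-involutive; ⁻¹-anti-homo-∙; ε⁻¹≈ε)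
  open import Relation.Binary.Reasoning.Setoid setoid

  infixl 7 _:∙_
  infix 8 _:⁻¹

  data Expr (k : ℕ) : Set where
    var  : Fin k → Expr k
    :ε   : Expr k
    _:∙_ : Expr k → Expr k → Expr k
    _:⁻¹ : Expr k → Expr k

  ⟦_⟧ : ∀ {k} → Expr k → Vec Carrier k → Carrier
  ⟦ var i  ⟧ ρ = lookup ρ i
  ⟦ :ε     ⟧ ρ = ε
  ⟦ e :∙ f ⟧ ρ = ⟦ e ⟧ ρ ∙ ⟦ f ⟧ ρ
  ⟦ e :⁻¹  ⟧ ρ = ⟦ e ⟧ ρ ⁻¹

  -- A letter (i , true) stands for the i-th variable, (i , false) for its inverse.
  Letter : ℕ → Set
  Letter k = Fin k × Bool

  Word : ℕ → Set
  Word k = List (Letter k)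

  module _ {k} (ρ : Vec Carrier k) where
    ⟦_⟧ₗ : Letter k → Carrier
    ⟦ i , true  ⟧ₗ = lookup ρ i
    ⟦ i , false ⟧ₗ = lookup ρ i ⁻¹

    ⟦_⟧w : Word k → Carrier
    ⟦ []    ⟧w = ε
    ⟦ l ∷ w ⟧w = ⟦ l ⟧ₗ ∙ ⟦ w ⟧w

  flip : ∀ {k} → Letter k → Letter k
  flip (i , b) = i , not b

  ⟦flip⟧ : ∀ {k} (ρ : Vec Carrier k) l → ⟦ ρ ⟧ₗ (flip l) ≈ ⟦ ρ ⟧ₗ l ⁻¹
  ⟦flip⟧ ρ (i , true)  = ≈-refl
  ⟦flip⟧ ρ (i , false) = ≈-sym (⁻¹-involutive _)

  l∙flip-cancel : ∀ {k} (ρ : Vec Carrier k) l w → ⟦ ρ ⟧ₗ l ∙ (⟦ ρ ⟧ₗ (flip l) ∙ w) ≈ w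
  l∙flip-cancel ρ l w = begin
    ⟦ ρ ⟧ₗ l ∙ (⟦ ρ ⟧ₗ (flip l) ∙ w)  ≈⟨ assoc _ _ _ ⟨
    (⟦ ρ ⟧ₗ l ∙ ⟦ ρ ⟧ₗ (flip l)) ∙ w  ≈⟨ ∙-congʳ (∙-congˡ (⟦flip⟧ ρ l)) ⟩
    (⟦ ρ ⟧ₗ l ∙ ⟦ ρ ⟧ₗ l ⁻¹) ∙ w      ≈⟨ ∙-congʳ (inverseʳ _) ⟩
    ε ∙ w                             ≈⟨ identityˡ w ⟩
    w                                 ∎

  infixr 5 _◁_
  _◁_ : ∀ {k} → Letter k → Word k → Word k
  l ◁ []       = l ∷ []
  l ◁ (l′ ∷ w) with ≡-dec Fin._≟_ Bool._≟_ l′ (flip l)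
  ... | yes refl = w
  ... | no _     = l ∷ l′ ∷ w

  ⟦◁⟧ : ∀ {k} (ρ : Vec Carrier k) l w → ⟦ ρ ⟧w (l ◁ w) ≈ ⟦ ρ ⟧ₗ l ∙ ⟦ ρ ⟧w w
  ⟦◁⟧ ρ l []       = ≈-refl
  ⟦◁⟧ ρ l (l′ ∷ w) with ≡-dec Fin._≟_ Bool._≟_ l′ (flip l)
  ... | yes refl = ≈-sym (l∙flip-cancel ρ l (⟦ ρ ⟧w w))
  ... | no _     = ≈-refl

  infixr 5 _++_
  _++_ : ∀ {k} → Word k → Word k → Word k
  []      ++ w′ = w′
  (l ∷ w) ++ w′ = l ◁ (w ++ w′)

  ⟦++⟧ : ∀ {k} (ρ : Vec Carrier k) w w′ → ⟦ ρ ⟧w (w ++ w′) ≈ ⟦ ρ ⟧w w ∙ ⟦ ρ ⟧w w′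
  ⟦++⟧ ρ []      w′ = ≈-sym (identityˡ _)
  ⟦++⟧ ρ (l ∷ w) w′ = begin
    ⟦ ρ ⟧w (l ◁ (w ++ w′))              ≈⟨ ⟦◁⟧ ρ l (w ++ w′) ⟩
    ⟦ ρ ⟧ₗ l ∙ ⟦ ρ ⟧w (w ++ w′)          ≈⟨ ∙-congˡ (⟦++⟧ ρ w w′) ⟩
    ⟦ ρ ⟧ₗ l ∙ (⟦ ρ ⟧w w ∙ ⟦ ρ ⟧w w′)    ≈⟨ assoc _ _ _ ⟨
    ⟦ ρ ⟧w (l ∷ w) ∙ ⟦ ρ ⟧w w′          ∎

  invert : ∀ {k} → Word k → Word k
  invert []      = []
  invert (l ∷ w) = invert w ++ flip l ∷ []

  ⟦invert⟧ : ∀ {k} (ρ : Vec Carrier k) w → ⟦ ρ ⟧w (invert w) ≈ ⟦ ρ ⟧w w ⁻¹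
  ⟦invert⟧ ρ []      = ≈-sym ε⁻¹≈ε
  ⟦invert⟧ ρ (l ∷ w) = begin
    ⟦ ρ ⟧w (invert w ++ flip l ∷ [])          ≈⟨ ⟦++⟧ ρ (invert w) (flip l ∷ []) ⟩
    ⟦ ρ ⟧w (invert w) ∙ (⟦ ρ ⟧ₗ (flip l) ∙ ε)  ≈⟨ ∙-cong (⟦invert⟧ ρ w) (identityʳ _) ⟩
    ⟦ ρ ⟧w w ⁻¹ ∙ ⟦ ρ ⟧ₗ (flip l)              ≈⟨ ∙-congˡ (⟦flip⟧ ρ l) ⟩
    ⟦ ρ ⟧w w ⁻¹ ∙ ⟦ ρ ⟧ₗ l ⁻¹                  ≈⟨ ⁻¹-anti-homo-∙ _ _ ⟨
    ⟦ ρ ⟧w (l ∷ w) ⁻¹                          ∎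

  normalise : ∀ {k} → Expr k → Word k
  normalise (var i)  = (i , true) ∷ []
  normalise :ε       = []
  normalise (e :∙ f) = normalise e ++ normalise f
  normalise (e :⁻¹)  = invert (normalise e)

  ⟦_⇓⟧ : ∀ {k} → Expr k → Vec Carrier k → Carrier
  ⟦ e ⇓⟧ ρ = ⟦ ρ ⟧w (normalise e)

  correct : ∀ {k} (e : Expr k) ρ → ⟦ e ⇓⟧ ρ ≈ ⟦ e ⟧ ρ
  correct (var i)  ρ = identityʳ _
  correct :ε       ρ = ≈-refl
  correct (e :∙ f) ρ = ≈-trans (⟦++⟧ ρ (normalise e) (normalise f)) (∙-cong (correct e ρ) (correct f ρ))
  correct (e :⁻¹)  ρ = ≈-trans (⟦invert⟧ ρ (normalise e)) (⁻¹-cong (correct e ρ))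

  open Reflection setoid var ⟦_⟧ ⟦_⇓⟧ correct public using (solve; _⊜_)

-- Counting over Fin m

indicator : Decidable P → Fin _ → ℕ
indicator P? i = if does (P? i) then 1 else 0

count : Decidable P → ℕ
count P? = sum (indicator P?)

count-reindex : (P? : Decidable P) (Q? : Decidable Q) (π : Permutation′ _) →
                (∀ {i} → Q i → P (π ⟨$⟩ʳ i)) → (∀ {i} → P (π ⟨$⟩ʳ i) → Q i) →
                count Q? ≡ count P?
count-reindex P? Q? π Q⇒Pπ Pπ⇒Q =
  trans (sum-cong-≗ pointwise) (sym (∑-permute (indicator P?) π))
  where
  pointwise : ∀ i → indicator Q? i ≡ indicator P? (π ⟨$⟩ʳ i)
  pointwise i with Q? i | P? (π ⟨$⟩ʳ i)
  ... | yes _  | yes _  = refl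
  ... | no  _  | no  _  = refl
  ... | yes qi | no ¬pi = contradiction (Q⇒Pπ qi) ¬pi
  ... | no ¬qi | yes pi = contradiction (Pπ⇒Q pi) ¬qi

count-cong : (P? : Decidable P) (Q? : Decidable Q) →
             (∀ {i} → Q i → P i) → (∀ {i} → P i → Q i) → count Q? ≡ count P?
count-cong P? Q? = count-reindex P? Q? Perm.id

count-≡0 : ∀ {m} {P : Pred (Fin m) p} (P? : Decidable P) → (∀ i → ¬ P i) → count P? ≡ 0
count-≡0 {m = m} P? ∄P = trans (sum-cong-≗ pointwise) (sum-replicate-zero m)
  where
  pointwise : ∀ i → indicator P? i ≡ 0
  pointwise i with P? i
  ... | yes pi = contradiction pi (∄P i)
  ... | no  _  = refl

count-pos : ∀ {m} {P : Pred (Fin m) p} (P? : Decidable P) {i : Fin m} → P i → 0 < count P?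
count-pos {m = suc _} P? {i} pi = begin-strict
  0                                             <⟨ indicator-pos ⟩
  indicator P? i                                ≤⟨ m≤m+n _ _ ⟩
  indicator P? i + sum (removeAt (indicator P?) i) ≡⟨ sum-remove (indicator P?) ⟨
  count P?                                      ∎
  where
  open ≤-Reasoning
  indicator-pos : 0 < indicator P? i
  indicator-pos with P? i
  ... | yes _   = s≤s z≤n
  ... | no ¬pi  = contradiction pi ¬pi

count-⊎ : (P? : Decidable P) (Q? : Decidable Q) → (∀ {i} → P i → ¬ Q i) →
          count (λ i → P? i ⊎-dec Q? i) ≡ count P? + count Q?
count-⊎ P? Q? disjoint = trans (sum-cong-≗ pointwise) (∑-distrib-+ (indicator P?) (indicator Q?))
  where
  pointwise : ∀ i → indicator (λ i → P? i ⊎-dec Q? i) i ≡ indicator P? i + indicator Q? i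
  pointwise i with P? i | Q? i
  ... | yes pi | yes qi = contradiction qi (disjoint pi)
  ... | yes _  | no  _  = refl
  ... | no  _  | yes _  = refl
  ... | no  _  | no  _  = refl

∑-count-fibres : ∀ {m m′ c} {P : Pred (Fin m) p} {E : Fin m → Fin m′ → Set q}
                 (P? : Decidable P) (E? : ∀ i j → Dec (E i j)) →
                 (∀ {i j} → E i j → P i) → (∀ {i} → P i → count (E? i) ≡ c) →
                 sum (λ i → count (E? i)) ≡ count P? * c
∑-count-fibres {c = c} P? E? E⇒P fibre = begin
  sum (λ i → count (E? i))             ≡⟨ sum-cong-≗ pointwise ⟩
  sum (λ i → indicator P? i * c)       ≡⟨ *-distribʳ-sum c (indicator P?) ⟨
  count P? * c                         ∎
  where
  open ≡-Reasoning
  pointwise : ∀ i → count (E? i) ≡ indicator P? i * c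
  pointwise i with P? i
  ... | yes pi = trans (fibre pi) (sym (+-identityʳ c))
  ... | no ¬pi = count-≡0 (E? i) (λ j eij → ¬pi (E⇒P eij))

count-double : ∀ {m m′ c d} {P : Pred (Fin m) p} {Q : Pred (Fin m′) q} {E : Fin m → Fin m′ → Set r}
               (P? : Decidable P) (Q? : Decidable Q) (E? : ∀ i j → Dec (E i j)) →
               (∀ {i j} → E i j → P i) → (∀ {i} → P i → count (E? i) ≡ c) →
               (∀ {i j} → E i j → Q j) → (∀ {j} → Q j → count (λ i → E? i j) ≡ d) →
               count P? * c ≡ count Q? * d
count-double {c = c} {d = d} P? Q? E? E⇒P P-fibre E⇒Q Q-fibre = begin
  count P? * c                         ≡⟨ ∑-count-fibres P? E? E⇒P P-fibre ⟨
  sum (λ i → count (E? i))             ≡⟨ ∑-comm (λ i j → indicator (E? i) j) ⟩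
  sum (λ j → count (λ i → E? i j))     ≡⟨ ∑-count-fibres Q? (λ j i → E? i j) E⇒Q Q-fibre ⟩
  count Q? * d                         ∎
  where open ≡-Reasoning

∣p∣≡count∈ : ∀ {m} (S : Subset m) → ∣ S ∣ ≡ count (_∈? S)
∣p∣≡count∈ []             = refl
∣p∣≡count∈ (inside  ∷ S) = cong suc (∣p∣≡count∈ S)
∣p∣≡count∈ (outside ∷ S) = ∣p∣≡count∈ S

module _ {m} {R : Rel (Fin m) r} (R-isDecEquivalence : IsDecEquivalence R) where
  open IsDecEquivalence R-isDecEquivalence using (_≟_) renaming (refl to R-refl; sym to R-sym; trans to R-trans)

  ∣classes⇒∣count : ∀ {d} {S : Pred (Fin m) p} (S? : Decidable S) →
                    (∀ {s t} → S s → R s t → S t) → (∀ {s} → S s → d ∣ count (s ≟_)) →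
                    d ∣ count S?
  ∣classes⇒∣count S? = go _ S? ≤-refl
    where
    go : ∀ {d} {S : Pred (Fin m) p} N (S? : Decidable S) → count S? ≤ N →
         (∀ {s t} → S s → R s t → S t) → (∀ {s} → S s → d ∣ count (s ≟_)) →
         d ∣ count S?
    go N S? bound saturated class∣ with Fin.any? S?
    ... | no ∄s = subst (_ ∣_) (sym (count-≡0 S? (λ s Ss → ∄s (s , Ss)))) (_ ∣0)
    go zero S? bound saturated class∣ | yes (s , Ss) = contradiction bound (<⇒≱ (count-pos S? Ss))
    go {d = d} {S = S} (suc N) S? bound saturated class∣ | yes (s , Ss) =
      subst (d ∣_) (sym split) (∣m∣n⇒∣m+n rest∣ (class∣ Ss))
      where
      Rest : Pred (Fin m) _
      Rest t = S t × ¬ R s t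
      Rest? : Decidable Rest
      Rest? t = S? t ×-dec ¬? (s ≟ t)
      S⇒Rest⊎R : ∀ {t} → S t → Rest t ⊎ R s t
      S⇒Rest⊎R {t} St with s ≟ t
      ... | yes Rst = inj₂ Rst
      ... | no ¬Rst = inj₁ (St , ¬Rst)
      Rest⊎R⇒S : ∀ {t} → Rest t ⊎ R s t → S t
      Rest⊎R⇒S (inj₁ (St , _)) = St
      Rest⊎R⇒S (inj₂ Rst)      = saturated Ss Rst
      split : count S? ≡ count Rest? + count (s ≟_)
      split = trans (count-cong (λ t → Rest? t ⊎-dec (s ≟ t)) S? S⇒Rest⊎R Rest⊎R⇒S)
                    (count-⊎ Rest? (s ≟_) proj₂)
      rest-bound : count Rest? ≤ N
      rest-bound = s≤s⁻¹ (begin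
        suc (count Rest?)             ≡⟨ +-comm 1 _ ⟩
        count Rest? + 1               ≤⟨ +-monoʳ-≤ (count Rest?) (count-pos (s ≟_) R-refl) ⟩
        count Rest? + count (s ≟_)    ≡⟨ split ⟨
        count S?                      ≤⟨ bound ⟩
        suc N                         ∎)
        where open ≤-Reasoning
      rest-saturated : ∀ {t u} → Rest t → R t u → Rest u
      rest-saturated (St , ¬Rst) Rtu = saturated St Rtu , λ Rsu → ¬Rst (R-trans Rsu (R-sym Rtu))
      rest∣ : d ∣ count Rest?
      rest∣ = go N Rest? rest-bound rest-saturated (class∣ ∘ proj₁)

∈⇒∣p∣-nonZero : ∀ {m} {S : Subset m} {i} → i ∈ S → NonZero ∣ S ∣
∈⇒∣p∣-nonZero i∈S = >-nonZero (m<n⇒0<n (x∈p⇒∣p-x∣<∣p∣ i∈S))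

index-even : ∀ {a b c h k} .{{_ : NonZero b}} .{{_ : NonZero h}} →
             a ≡ k * b → a * h ≡ c * b → 2 * h ∣ c → 2 ∣ k
index-even {a} {b} {c} {h} {k} a≡kb ah≡cb (divides q c≡q2h) =
  divides q (*-cancelʳ-≡ k (q * 2) h (*-cancelʳ-≡ (k * h) (q * 2 * h) b (begin
    k * h * b        ≡⟨ *-assoc k h b ⟩
    k * (h * b)      ≡⟨ cong (k *_) (*-comm h b) ⟩
    k * (b * h)      ≡⟨ *-assoc k b h ⟨
    k * b * h        ≡⟨ cong (_* h) a≡kb ⟨
    a * h            ≡⟨ ah≡cb ⟩
    c * b            ≡⟨ cong (_* b) c≡q2h ⟩
    q * (2 * h) * b  ≡⟨ cong (_* b) (*-assoc q 2 h) ⟨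
    q * 2 * h * b    ∎)))
  where open ≡-Reasoning

-- Cosets, double cosets and the coset graph

module FiniteGroup (G : FinGroup) where
  open FinGroup G

  group : Group 0ℓ 0ℓ
  group = record { isGroup = isGroup }

  open GroupWords group using (solve; _⊜_; :ε; _:∙_; _:⁻¹)
  open import Algebra.Properties.Group group using (⁻¹-involutive)

  -- t ∈ K s L, witnessed by the factor l ∈ L in t = k⁻¹ s l (so that k = s l t⁻¹ ∈ K).
  InDoubleCoset : Subset n → Fin n → Subset n → Pred (Fin n) 0ℓ
  InDoubleCoset K s L t = Σ (Fin n) λ l → l ∈ L × s ∙ l ∙ t ⁻¹ ∈ K

  inDoubleCoset? : ∀ K s L → Decidable (InDoubleCoset K s L)
  inDoubleCoset? K s L t = Fin.any? λ l → l ∈? L ×-dec s ∙ l ∙ t ⁻¹ ∈? K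

  ∈conjInter⁺ : ∀ {A x g} → g ∈ A → x ⁻¹ ∙ g ∙ x ∈ A → g ∈ conjInter G A x
  ∈conjInter⁺ {A} {x} {g} g∈A gˣ∈A = lookup⇒[]= g _ (begin
    lookup (conjInter G A x) g                ≡⟨ lookup∘tabulate _ g ⟩
    lookup A g ∧ lookup A (x ⁻¹ ∙ g ∙ x)      ≡⟨ cong₂ _∧_ ([]=⇒lookup g∈A) ([]=⇒lookup gˣ∈A) ⟩
    true                                      ∎)
    where open ≡-Reasoning

  ∈conjInter⁻ : ∀ {A x g} → g ∈ conjInter G A x → g ∈ A × x ⁻¹ ∙ g ∙ x ∈ A
  ∈conjInter⁻ {A} {x} {g} g∈B
    with lookup A g in g∈A | lookup A (x ⁻¹ ∙ g ∙ x) in gˣ∈A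
       | trans (sym (lookup∘tabulate _ g)) ([]=⇒lookup g∈B)
  ... | true  | true  | _  = lookup⇒[]= g A g∈A , lookup⇒[]= _ A gˣ∈A
  ... | true  | false | ()
  ... | false | _     | ()

  e∈conjInter : ∀ {A} → IsSubgroup G A → ∀ x → e ∈ conjInter G A x
  e∈conjInter A≤G x = ∈conjInter⁺ A.e∈ (subst (_∈ _) (solve 1 (λ x → :ε ⊜ x :⁻¹ :∙ :ε :∙ x) refl x) A.e∈)
    where module A = IsSubgroup A≤G

  module Subgroup {H : Subset n} (H≤G : IsSubgroup G H) where
    private module H = IsSubgroup H≤G

    sameCoset-isDecEquivalence : IsDecEquivalence (SameCoset G H)
    sameCoset-isDecEquivalence = record
      { isEquivalence = record
        { refl  = λ {s} → subst (_∈ H) (sym (inverseˡ s)) H.e∈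
        ; sym   = λ {s} {t} p → subst (_∈ H) (solve 2 (λ s t → (s :⁻¹ :∙ t) :⁻¹ ⊜ t :⁻¹ :∙ s) refl s t) (H.⁻¹∈ p)
        ; trans = λ {s} {t} {u} p q → subst (_∈ H) (solve 3 (λ s t u → (s :⁻¹ :∙ t) :∙ (t :⁻¹ :∙ u) ⊜ s :⁻¹ :∙ u) refl s t u) (H.∙∈ p q)
        }
      ; _≟_ = λ s t → s ⁻¹ ∙ t ∈? H
      }
      where open IsGroup isGroup using (inverseˡ)

    count-leftCoset : ∀ s → count (λ t → s ⁻¹ ∙ t ∈? H) ≡ ∣ H ∣
    count-leftCoset s = trans
      (count-reindex (_∈? H) (λ t → s ⁻¹ ∙ t ∈? H) (permutation (s ⁻¹ ∙_) (s ∙_) cancel cancel⁻¹) id id)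
      (sym (∣p∣≡count∈ H))
      where
      cancel : ∀ t → s ⁻¹ ∙ (s ∙ t) ≡ t
      cancel = solve 2 (λ s t → s :⁻¹ :∙ (s :∙ t) ⊜ t) refl s
      cancel⁻¹ : ∀ t → s ∙ (s ⁻¹ ∙ t) ≡ t
      cancel⁻¹ = solve 2 (λ s t → s :∙ (s :⁻¹ :∙ t) ⊜ t) refl s

    ∣H∣∣count : ∀ {p} {S : Pred (Fin n) p} (S? : Decidable S) → (∀ {s h} → S s → h ∈ H → S (s ∙ h)) →
                ∣ H ∣ ∣ count S?
    ∣H∣∣count {S = S} S? ∙H-closed = ∣classes⇒∣count sameCoset-isDecEquivalence S?
      (λ {s} {t} Ss s⁻¹t∈H → subst S (solve 2 (λ s t → s :∙ (s :⁻¹ :∙ t) ⊜ t) refl s t) (∙H-closed Ss s⁻¹t∈H))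
      (λ {s} _ → subst (∣ H ∣ ∣_) (sym (count-leftCoset s)) ∣-refl)

    doubleCoset-refl : ∀ {s} → InDoubleCoset H s H s
    doubleCoset-refl {s} = e , H.e∈ , subst (_∈ H) (sym (solve 1 (λ s → s :∙ :ε :∙ s :⁻¹ ⊜ :ε) refl s)) H.e∈

    doubleCoset-sym : ∀ {s t} → InDoubleCoset H s H t → InDoubleCoset H t H s
    doubleCoset-sym {s} {t} (l , l∈H , k∈H) = l ⁻¹ , H.⁻¹∈ l∈H ,
      subst (_∈ H) (solve 3 (λ s t l → (s :∙ l :∙ t :⁻¹) :⁻¹ ⊜ t :∙ l :⁻¹ :∙ s :⁻¹) refl s t l) (H.⁻¹∈ k∈H)

    doubleCoset-trans : ∀ {s t u} → InDoubleCoset H s H t → InDoubleCoset H t H u → InDoubleCoset H s H u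
    doubleCoset-trans {s} {t} {u} (l , l∈H , k∈H) (l′ , l′∈H , k′∈H) = l ∙ l′ , H.∙∈ l∈H l′∈H ,
      subst (_∈ H) (solve 5 (λ s t u l l′ → (s :∙ l :∙ t :⁻¹) :∙ (t :∙ l′ :∙ u :⁻¹) ⊜ s :∙ (l :∙ l′) :∙ u :⁻¹) refl s t u l l′)
        (H.∙∈ k∈H k′∈H)

    doubleCoset-⁻¹ : ∀ {s t} → InDoubleCoset H s H t → InDoubleCoset H (s ⁻¹) H (t ⁻¹)
    doubleCoset-⁻¹ {s} {t} (l , l∈H , k∈H) = s ∙ l ∙ t ⁻¹ , k∈H ,
      subst (_∈ H) (solve 3 (λ s t l → l ⊜ s :⁻¹ :∙ (s :∙ l :∙ t :⁻¹) :∙ t :⁻¹ :⁻¹) refl s t l) l∈H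

    doubleCoset-∙ʳ : ∀ {s t h} → InDoubleCoset H s H t → h ∈ H → InDoubleCoset H s H (t ∙ h)
    doubleCoset-∙ʳ {s} {t} {h} (l , l∈H , k∈H) h∈H = l ∙ h , H.∙∈ l∈H h∈H ,
      subst (_∈ H) (solve 4 (λ s t l h → s :∙ l :∙ t :⁻¹ ⊜ s :∙ (l :∙ h) :∙ (t :∙ h) :⁻¹) refl s t l h) k∈H

    doubleCoset-⁻¹ˡ : ∀ {s t} → InDoubleCoset H (s ⁻¹) H t → InDoubleCoset H s H (t ⁻¹)
    doubleCoset-⁻¹ˡ {s} {t} d = subst (λ r → InDoubleCoset H r H (t ⁻¹)) (⁻¹-involutive s) (doubleCoset-⁻¹ d)

    doubleCoset-⁻¹ʳ : ∀ {s t} → InDoubleCoset H s H (t ⁻¹) → InDoubleCoset H (s ⁻¹) H t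
    doubleCoset-⁻¹ʳ {s} {t} d = subst (InDoubleCoset H (s ⁻¹) H) (⁻¹-involutive t) (doubleCoset-⁻¹ d)

    count-doubleCoset-⁻¹ : ∀ s → count (inDoubleCoset? H (s ⁻¹) H) ≡ count (inDoubleCoset? H s H)
    count-doubleCoset-⁻¹ s = count-reindex (inDoubleCoset? H s H) (inDoubleCoset? H (s ⁻¹) H)
      (permutation _⁻¹ _⁻¹ ⁻¹-involutive ⁻¹-involutive) doubleCoset-⁻¹ˡ doubleCoset-⁻¹ʳ

    ∣H∣∣count-doubleCoset : ∀ s → ∣ H ∣ ∣ count (inDoubleCoset? H s H)
    ∣H∣∣count-doubleCoset s = ∣H∣∣count (inDoubleCoset? H s H) doubleCoset-∙ʳ

    Paired : Fin n → Fin n → Set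
    Paired s t = InDoubleCoset H s H t ⊎ InDoubleCoset H (s ⁻¹) H t

    paired-isDecEquivalence : IsDecEquivalence Paired
    paired-isDecEquivalence = record
      { isEquivalence = record { refl = inj₁ doubleCoset-refl ; sym = paired-sym ; trans = paired-trans }
      ; _≟_ = λ s t → inDoubleCoset? H s H t ⊎-dec inDoubleCoset? H (s ⁻¹) H t
      }
      where
      paired-sym : ∀ {s t} → Paired s t → Paired t s
      paired-sym (inj₁ d) = inj₁ (doubleCoset-sym d)
      paired-sym (inj₂ d) = inj₂ (doubleCoset-⁻¹ʳ (doubleCoset-sym d))
      paired-trans : ∀ {s t u} → Paired s t → Paired t u → Paired s u
      paired-trans (inj₁ d) (inj₁ d′) = inj₁ (doubleCoset-trans d d′)
      paired-trans (inj₁ d) (inj₂ d′) = inj₂ (doubleCoset-trans (doubleCoset-⁻¹ d) d′)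
      paired-trans (inj₂ d) (inj₁ d′) = inj₂ (doubleCoset-trans d d′)
      paired-trans (inj₂ d) (inj₂ d′) = inj₁ (doubleCoset-trans (doubleCoset-⁻¹ˡ d) d′)

    2∣H∣∣count : ∀ {p} {Q : Pred (Fin n) p} (Q? : Decidable Q) →
                 (∀ {s t} → Q s → InDoubleCoset H s H t → Q t) → (∀ {s} → Q s → Q (s ⁻¹)) →
                 (∀ {s} → Q s → ¬ InDoubleCoset H s H (s ⁻¹)) →
                 2 * ∣ H ∣ ∣ count Q?
    2∣H∣∣count {Q = Q} Q? saturated ⁻¹-closed not-self-paired =
      ∣classes⇒∣count paired-isDecEquivalence Q? paired-saturated pair∣
      where
      paired-saturated : ∀ {s t} → Q s → Paired s t → Q t
      paired-saturated Qs (inj₁ d) = saturated Qs d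
      paired-saturated Qs (inj₂ d) = saturated (⁻¹-closed Qs) d
      pair∣ : ∀ {s} → Q s → 2 * ∣ H ∣ ∣ count (λ t → inDoubleCoset? H s H t ⊎-dec inDoubleCoset? H (s ⁻¹) H t)
      pair∣ {s} Qs = subst (2 * ∣ H ∣ ∣_) (sym (begin
        count (λ t → inDoubleCoset? H s H t ⊎-dec inDoubleCoset? H (s ⁻¹) H t)
          ≡⟨ count-⊎ (inDoubleCoset? H s H) (inDoubleCoset? H (s ⁻¹) H)
                     (λ d d′ → not-self-paired Qs (doubleCoset-trans d (doubleCoset-sym d′))) ⟩
        count (inDoubleCoset? H s H) + count (inDoubleCoset? H (s ⁻¹) H)
          ≡⟨ cong (count (inDoubleCoset? H s H) +_) (count-doubleCoset-⁻¹ s) ⟩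
        count (inDoubleCoset? H s H) + count (inDoubleCoset? H s H)
          ≡⟨ cong (count (inDoubleCoset? H s H) +_) (+-identityʳ _) ⟨
        2 * count (inDoubleCoset? H s H) ∎))
        (*-monoʳ-∣ 2 (∣H∣∣count-doubleCoset s))
        where open ≡-Reasoning

  module CosetGraph {H A U : Subset n} (H≤G : IsSubgroup G H) (A≤G : IsSubgroup G A) (H⊆A : _⊆ₛ_ G H A)
                    (U-conn : IsConnectionSet G H U) (x : Fin n) where
    open Subgroup H≤G using (doubleCoset-refl; doubleCoset-∙ʳ)
    private
      module H = IsSubgroup H≤G
      module A = IsSubgroup A≤G
      module U = IsConnectionSet U-conn

    U∩AxA : Pred (Fin n) 0ℓ
    U∩AxA u = u ∈ U × InDoubleCoset A x A u

    u∩AxA? : Decidable U∩AxA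
    u∩AxA? u = u ∈? U ×-dec inDoubleCoset? A x A u

    -- The edge of Cos(G,H,U) from aH to xcH, where a = xcu⁻¹, is labelled by u = a⁻¹xc.
    Incident : Fin n → Fin n → Set
    Incident c u = u ∈ U × c ∈ A × x ∙ c ∙ u ⁻¹ ∈ A

    incident? : ∀ c u → Dec (Incident c u)
    incident? c u = u ∈? U ×-dec c ∈? A ×-dec x ∙ c ∙ u ⁻¹ ∈? A

    u∩AxA-saturated : ∀ {s t} → U∩AxA s → InDoubleCoset H s H t → U∩AxA t
    u∩AxA-saturated {s} {t} (s∈U , c , c∈A , a∈A) (l , l∈H , k∈H) =
      subst (_∈ U) (solve 3 (λ s t l → (s :∙ l :∙ t :⁻¹) :⁻¹ :∙ s :∙ l ⊜ t) refl s t l)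
        (U.doubleCosetUnion (H.⁻¹∈ k∈H) s∈U l∈H) ,
      c ∙ l , A.∙∈ c∈A (H⊆A l∈H) ,
      subst (_∈ A) (solve 5 (λ x c s t l → (x :∙ c :∙ s :⁻¹) :∙ (s :∙ l :∙ t :⁻¹) ⊜ x :∙ (c :∙ l) :∙ t :⁻¹) refl x c s t l)
        (A.∙∈ a∈A (H⊆A k∈H))

    u∩AxA-⁻¹ : x ∙ x ∈ A → ∀ {s} → U∩AxA s → U∩AxA (s ⁻¹)
    u∩AxA-⁻¹ x²∈A {s} (s∈U , c , c∈A , a∈A) =
      U.inverseClosed s∈U ,
      (x ∙ x) ⁻¹ ∙ (x ∙ c ∙ s ⁻¹) , A.∙∈ (A.⁻¹∈ x²∈A) a∈A ,
      subst (_∈ A) (solve 3 (λ x c s → c ⊜ x :∙ ((x :∙ x) :⁻¹ :∙ (x :∙ c :∙ s :⁻¹)) :∙ s :⁻¹ :⁻¹) refl x c s) c∈A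

    -- z = sl lies in U ∩ AxA and z² = (sls)l ∈ H; writing z = a⁻¹xc, z² = a⁻¹(xca⁻¹)²a.
    u∩AxA-not-self-paired : (∀ {a b} → a ∈ A → b ∈ A → ¬ (b ∙ ((x ∙ a) ∙ (x ∙ a)) ∙ b ⁻¹ ∈ H)) →
                            ∀ {s} → U∩AxA s → ¬ InDoubleCoset H s H (s ⁻¹)
    u∩AxA-not-self-paired no-square {s} s∈U∩AxA (l , l∈H , k∈H)
      with u∩AxA-saturated s∈U∩AxA (doubleCoset-∙ʳ doubleCoset-refl l∈H)
    ... | _ , c , c∈A , a∈A =
      no-square (A.∙∈ c∈A (A.⁻¹∈ a∈A)) (A.⁻¹∈ a∈A) (subst (_∈ H) square-as-conjugate (H.∙∈ k∈H l∈H))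
      where
      a : Fin n
      a = x ∙ c ∙ (s ∙ l) ⁻¹
      square-as-conjugate : s ∙ l ∙ s ⁻¹ ⁻¹ ∙ l ≡ a ⁻¹ ∙ ((x ∙ (c ∙ a ⁻¹)) ∙ (x ∙ (c ∙ a ⁻¹))) ∙ a ⁻¹ ⁻¹
      square-as-conjugate = solve 4 (λ x c s l → let a = x :∙ c :∙ (s :∙ l) :⁻¹ in
        s :∙ l :∙ s :⁻¹ :⁻¹ :∙ l ⊜ a :⁻¹ :∙ ((x :∙ (c :∙ a :⁻¹)) :∙ (x :∙ (c :∙ a :⁻¹))) :∙ a :⁻¹ :⁻¹) refl x c s l

    count-incident-to : ∀ {u} → U∩AxA u → count (λ c → incident? c u) ≡ ∣ conjInter G A x ∣
    count-incident-to {u} (u∈U , c₀ , c₀∈A , a₀∈A) = trans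
      (count-reindex (_∈? conjInter G A x) (λ c → incident? c u) (permutation conj unconj conj∘unconj unconj∘conj)
         to from)
      (sym (∣p∣≡count∈ (conjInter G A x)))
      where
      conj unconj : Fin n → Fin n
      conj c   = x ∙ (c ∙ c₀ ⁻¹) ∙ x ⁻¹
      unconj b = x ⁻¹ ∙ b ∙ x ∙ c₀
      conj∘unconj : ∀ b → conj (unconj b) ≡ b
      conj∘unconj = solve 3 (λ x c₀ b → x :∙ (x :⁻¹ :∙ b :∙ x :∙ c₀ :∙ c₀ :⁻¹) :∙ x :⁻¹ ⊜ b) refl x c₀
      unconj∘conj : ∀ c → unconj (conj c) ≡ c
      unconj∘conj = solve 3 (λ x c₀ c → x :⁻¹ :∙ (x :∙ (c :∙ c₀ :⁻¹) :∙ x :⁻¹) :∙ x :∙ c₀ ⊜ c) refl x c₀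
      to : ∀ {c} → Incident c u → conj c ∈ conjInter G A x
      to {c} (_ , c∈A , a∈A) = ∈conjInter⁺
        (subst (_∈ A) (solve 4 (λ x c c₀ u → (x :∙ c :∙ u :⁻¹) :∙ (x :∙ c₀ :∙ u :⁻¹) :⁻¹ ⊜ x :∙ (c :∙ c₀ :⁻¹) :∙ x :⁻¹) refl x c c₀ u)
           (A.∙∈ a∈A (A.⁻¹∈ a₀∈A)))
        (subst (_∈ A) (solve 3 (λ x c c₀ → c :∙ c₀ :⁻¹ ⊜ x :⁻¹ :∙ (x :∙ (c :∙ c₀ :⁻¹) :∙ x :⁻¹) :∙ x) refl x c c₀)
           (A.∙∈ c∈A (A.⁻¹∈ c₀∈A)))
      from : ∀ {c} → conj c ∈ conjInter G A x → Incident c u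
      from {c} b∈B with ∈conjInter⁻ b∈B
      ... | b∈A , bˣ∈A = u∈U ,
        subst (_∈ A) (unconj∘conj c) (A.∙∈ bˣ∈A c₀∈A) ,
        subst (_∈ A) (solve 4 (λ x c c₀ u → (x :∙ (c :∙ c₀ :⁻¹) :∙ x :⁻¹) :∙ (x :∙ c₀ :∙ u :⁻¹) ⊜ x :∙ c :∙ u :⁻¹) refl x c c₀ u)
          (A.∙∈ b∈A a₀∈A)

    module _ (code : IsPerfectCodeIn G H U A) (x∉A : x ∉ A) where
      private module C = IsPerfectCodeIn code

      x∙c∉A : ∀ {c} → c ∈ A → x ∙ c ∉ A
      x∙c∉A {c} c∈A xc∈A = x∉A (subst (_∈ A) (solve 2 (λ x c → x :∙ c :∙ c :⁻¹ ⊜ x) refl x c) (A.∙∈ xc∈A (A.⁻¹∈ c∈A)))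

      count-incident-from : ∀ {c} → c ∈ A → count (incident? c) ≡ ∣ H ∣
      count-incident-from {c} c∈A with C.covers (x∙c∉A c∈A)
      ... | a₀ , a₀∈A , a₀~xc = trans
        (count-reindex (_∈? H) (incident? c) (permutation coset uncoset coset∘uncoset uncoset∘coset) to from)
        (sym (∣p∣≡count∈ H))
        where
        coset uncoset : Fin n → Fin n
        coset u   = a₀ ⁻¹ ∙ (x ∙ c ∙ u ⁻¹)
        uncoset h = (a₀ ∙ h) ⁻¹ ∙ (x ∙ c)
        coset∘uncoset : ∀ h → coset (uncoset h) ≡ h
        coset∘uncoset = solve 4 (λ a₀ x c h → a₀ :⁻¹ :∙ (x :∙ c :∙ ((a₀ :∙ h) :⁻¹ :∙ (x :∙ c)) :⁻¹) ⊜ h) refl a₀ x c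
        uncoset∘coset : ∀ u → uncoset (coset u) ≡ u
        uncoset∘coset = solve 4 (λ a₀ x c u → (a₀ :∙ (a₀ :⁻¹ :∙ (x :∙ c :∙ u :⁻¹))) :⁻¹ :∙ (x :∙ c) ⊜ u) refl a₀ x c
        to : ∀ {u} → Incident c u → coset u ∈ H
        to {u} (u∈U , _ , a∈A) = C.unique (x∙c∉A c∈A) a₀∈A a∈A a₀~xc
          (subst (_∈ U) (solve 3 (λ x c u → u ⊜ (x :∙ c :∙ u :⁻¹) :⁻¹ :∙ (x :∙ c)) refl x c u) u∈U)
        from : ∀ {u} → coset u ∈ H → Incident c u
        from {u} h∈H =
          subst (_∈ U) (solve 4 (λ a₀ x c u → (a₀ :⁻¹ :∙ (x :∙ c :∙ u :⁻¹)) :⁻¹ :∙ (a₀ :⁻¹ :∙ (x :∙ c)) :∙ :ε ⊜ u) refl a₀ x c u)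
            (U.doubleCosetUnion (H.⁻¹∈ h∈H) a₀~xc H.e∈) ,
          c∈A ,
          subst (_∈ A) (solve 4 (λ a₀ x c u → a₀ :∙ (a₀ :⁻¹ :∙ (x :∙ c :∙ u :⁻¹)) ⊜ x :∙ c :∙ u :⁻¹) refl a₀ x c u)
            (A.∙∈ a₀∈A (H⊆A h∈H))

      ∣A∣∣H∣≡∣U∩AxA∣∣B∣ : ∣ A ∣ * ∣ H ∣ ≡ count u∩AxA? * ∣ conjInter G A x ∣
      ∣A∣∣H∣≡∣U∩AxA∣∣B∣ = trans (cong (_* ∣ H ∣) (∣p∣≡count∈ A))
        (count-double (_∈? A) u∩AxA? incident? (proj₁ ∘ proj₂) count-incident-from
           (λ (u∈U , c∈A , a∈A) → u∈U , _ , c∈A , a∈A) count-incident-to)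

corollary3p8 : (G : FinGroup) → let open FinGroup G in
    (H A : Subset n) → IsSubgroup G H → IsSubgroup G A → _⊆ₛ_ G H A →
    (x : Fin n) → x ∉ A → x ∙ x ∈ A →
    (∀ {a b} → a ∈ A → b ∈ A → ¬ (b ∙ ((x ∙ a) ∙ (x ∙ a)) ∙ b ⁻¹ ∈ H)) →
    OddIndex G A (conjInter G A x) →
    ¬ IsPerfectCodeOfPair G H A
corollary3p8 G H A H≤G A≤G H⊆A x x∉A x²∈A no-square (k , ∣A∣≡k∣B∣ , k-odd) (U , U-conn , code) =
  contradiction (trans (sym k-odd) (n∣m⇒m%n≡0 k 2 2∣k)) λ ()
  where
  open FiniteGroup G
  open Subgroup H≤G using (2∣H∣∣count)
  open CosetGraph H≤G A≤G H⊆A U-conn x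
  2∣k : 2 ∣ k
  2∣k = index-even {{∈⇒∣p∣-nonZero (e∈conjInter A≤G x)}} {{∈⇒∣p∣-nonZero (IsSubgroup.e∈ H≤G)}}
    ∣A∣≡k∣B∣ (∣A∣∣H∣≡∣U∩AxA∣∣B∣ code x∉A)
    (2∣H∣∣count u∩AxA? u∩AxA-saturated (u∩AxA-⁻¹ x²∈A) (u∩AxA-not-self-paired no-square))
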